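{- Let $(Q_k)_{k\ge 0}$ be the Pell–Lucas sequence. If there exist integers $k\ge 0$, $n\ge 2$, $m\ge 1$ and digits $a_1,a_2\in\{1,\ldots,9\}$ such that $$Q_k=a_1\cdot\frac{10^n-1}{9}-a_2\cdot\frac{10^m-1}{9},$$ then $Q_k\in\{2,5,6,14,34,82,478\}$. Moreover the following representations hold: $2=11-9$, $6=11-5$, $14=22-8$, $34=111-77$, $82=88-6$, $478=555-77$.
   Context: The Pell–Lucas numbers are defined by $Q_0=Q_1=2$ and $Q_{k+2}=2Q_{k+1}+Q_k$ for all $k\ge 0$. A repdigit is a positive integer of the form $a\cdot\frac{10^m-1}{9}$ with $m\ge 1$ and $a\in\{1,\ldots,9\}$, i.e. all of whose decimal digits are equal. -}

module Defs where

open import Data.Nat using (ℕ; zero; suc; _+_; _*_; _^_; _∸_)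
open import Data.Nat.DivMod using (_/_)

Q : ℕ → ℕ
Q zero = 2
Q (suc zero) = 2
Q (suc (suc k)) = 2 * Q (suc k) + Q k

repunit : ℕ → ℕ
repunit m = (10 ^ m ∸ 1) / 9

repdigit : ℕ → ℕ → ℕ
repdigit a m = a * repunit m

{-# OPTIONS --safe #-}
module Submission where

open import Defs
open import Data.Nat using (ℕ; _+_; _≤_; _∸_)
open import Data.Product using (_×_)
open import Data.Sum using (_⊎_)
open import Relation.Binary.PropositionalEquality using (_≡_)

open import Data.Nat using (zero; suc; _*_; _^_; _<_; s≤s; NonZero; >-nonZero)
open import Data.Nat.Properties
open import Data.Nat.DivMod
open import Data.Nat.Divisibility using (divides; ∣-refl; _∣_; _∤_; _∣?_; n∣m*n)
open import Data.Nat.GeneralisedArithmetic using (iterate)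
open import Data.Nat.Tactic.RingSolver using (solve-∀)
open import Data.List as List using (List; []; _∷_; applyUpTo; map)
open import Data.List.Membership.Propositional using (_∈_)
open import Data.List.Membership.Propositional.Properties using (∈-applyUpTo⁺; ∈-map⁺)
open import Data.List.Relation.Unary.All as All using (All; all?)
open import Data.List.Relation.Unary.Any using (here; there)
open import Data.Product using (_,_; proj₁; proj₂)
open import Data.Sum using (inj₁; inj₂; [_,_]′)
open import Function using (id; _∘_)
open import Data.Empty using (⊥; ⊥-elim)
open import Relation.Nullary using (¬_)
open import Relation.Nullary.Decidable using (Dec; toWitness; ¬?; _×-dec_; _⊎-dec_)
open import Relation.Binary.PropositionalEquality
  using (_≢_; refl; sym; trans; cong; cong₂; subst; subst₂; module ≡-Reasoning)

-- For n ≤ 3 the right-hand side is at most 999, which leaves Q 0, …, Q 7 and, for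
-- Q 6 = 198, finitely many digit patterns. For n ≥ 4 we work modulo M = 10⁴ · 11 · 1201.
-- Modulo 10⁴ every repunit with at least four digits is 1111, so Q k + a₂ · rep m must end
-- in the four digits of a₁ · 1111; modulo M the Pell–Lucas numbers have period 3000 and
-- the repunits with at least four digits have period 200. A finite computation over these
-- residues leaves no solution.

private variable
  A : Set

rep : ℕ → ℕ
rep zero    = 0
rep (suc m) = 10 * rep m + 1

10^≡9*rep+1 : ∀ m → 10 ^ m ≡ 9 * rep m + 1
10^≡9*rep+1 zero    = refl
10^≡9*rep+1 (suc m) = trans (cong (10 *_) (10^≡9*rep+1 m)) (10*[9r+1]≡9*[10r+1]+1 (rep m))
  where
  10*[9r+1]≡9*[10r+1]+1 : ∀ r → 10 * (9 * r + 1) ≡ 9 * (10 * r + 1) + 1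
  10*[9r+1]≡9*[10r+1]+1 = solve-∀

repunit≡rep : ∀ m → repunit m ≡ rep m
repunit≡rep m = begin
  (10 ^ m ∸ 1) / 9          ≡⟨ cong (λ x → (x ∸ 1) / 9) (10^≡9*rep+1 m) ⟩
  (9 * rep m + 1 ∸ 1) / 9   ≡⟨ cong (_/ 9) (m+n∸n≡m (9 * rep m) 1) ⟩
  (9 * rep m) / 9           ≡⟨ cong (_/ 9) (*-comm 9 (rep m)) ⟩
  (rep m * 9) / 9           ≡⟨ m*n/n≡m (rep m) 9 ⟩
  rep m                     ∎
  where open ≡-Reasoning

1111≤rep : ∀ s → 1111 ≤ rep (4 + s)
1111≤rep zero    = ≤-refl
1111≤rep (suc s) = ≤-trans (1111≤rep s) (≤-trans (m≤n*m r 10) (m≤m+n (10 * r) 1))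
  where r = rep (4 + s)

iterate-suc : ∀ (f : A → A) x n → iterate f x (suc n) ≡ f (iterate f x n)
iterate-suc f x zero    = refl
iterate-suc f x (suc n) = iterate-suc f (f x) n

iterate-+ : ∀ (f : A → A) x m n → iterate f x (m + n) ≡ iterate f (iterate f x m) n
iterate-+ f x zero    n = refl
iterate-+ f x (suc m) n = iterate-+ f (f x) m n

iterate-fixed : ∀ (f : A → A) {x} → f x ≡ x → ∀ n → iterate f x n ≡ x
iterate-fixed f fx≡x zero    = refl
iterate-fixed f fx≡x (suc n) = trans (iterate-suc f _ n) (trans (cong f (iterate-fixed f fx≡x n)) fx≡x)

iterate-*-period : ∀ (f : A → A) {x} p → iterate f x p ≡ x → ∀ q → iterate f x (q * p) ≡ x
iterate-*-period f p period zero    = refl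
iterate-*-period f {x} p period (suc q) = begin
  iterate f x (p + q * p)               ≡⟨ iterate-+ f x p (q * p) ⟩
  iterate f (iterate f x p) (q * p)     ≡⟨ cong (λ y → iterate f y (q * p)) period ⟩
  iterate f x (q * p)                   ≡⟨ iterate-*-period f p period q ⟩
  x                                     ∎
  where open ≡-Reasoning

iterate-% : ∀ (f : A → A) {x} p .{{_ : NonZero p}} → iterate f x p ≡ x →
            ∀ n → iterate f x n ≡ iterate f x (n % p)
iterate-% f {x} p period n = begin
  iterate f x n                                   ≡⟨ cong (iterate f x) n≡[n/p]*p+n%p ⟩
  iterate f x ((n / p) * p + n % p)               ≡⟨ iterate-+ f x ((n / p) * p) (n % p) ⟩
  iterate f (iterate f x ((n / p) * p)) (n % p)   ≡⟨ cong (λ y → iterate f y (n % p)) (iterate-*-period f p period (n / p)) ⟩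
  iterate f x (n % p)                             ∎
  where
  open ≡-Reasoning
  n≡[n/p]*p+n%p : n ≡ (n / p) * p + n % p
  n≡[n/p]*p+n%p = trans (m≡m%n+[m/n]*n n p) (+-comm (n % p) ((n / p) * p))

recurrence⇒iterate : ∀ (f : A → A) (y : ℕ → A) → (∀ k → y (suc k) ≡ f (y k)) →
                     ∀ k → y k ≡ iterate f (y 0) k
recurrence⇒iterate f y step zero    = refl
recurrence⇒iterate f y step (suc k) =
  trans (step k) (trans (cong f (recurrence⇒iterate f y step k)) (sym (iterate-suc f (y 0) k)))

∈-iterate : ∀ (f : A → A) {x i n} → i < n → iterate f x i ∈ List.iterate f x n
∈-iterate f {i = zero}  {suc n} _           = here refl
∈-iterate f {i = suc i} {suc n} (s≤s i<n)   = there (∈-iterate f i<n)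

module _ {d} .{{_ : NonZero d}} {x x′ y y′ : ℕ} (x≡x′ : x % d ≡ x′ % d) (y≡y′ : y % d ≡ y′ % d) where
  open ≡-Reasoning

  %-cong-+ : (x + y) % d ≡ (x′ + y′) % d
  %-cong-+ = begin
    (x + y) % d             ≡⟨ %-distribˡ-+ x y d ⟩
    (x % d + y % d) % d     ≡⟨ cong₂ (λ u v → (u + v) % d) x≡x′ y≡y′ ⟩
    (x′ % d + y′ % d) % d   ≡⟨ sym (%-distribˡ-+ x′ y′ d) ⟩
    (x′ + y′) % d           ∎

  %-cong-* : (x * y) % d ≡ (x′ * y′) % d
  %-cong-* = begin
    (x * y) % d             ≡⟨ %-distribˡ-* x y d ⟩
    (x % d * (y % d)) % d   ≡⟨ cong₂ (λ u v → (u * v) % d) x≡x′ y≡y′ ⟩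
    (x′ % d * (y′ % d)) % d ≡⟨ sym (%-distribˡ-* x′ y′ d) ⟩
    (x′ * y′) % d           ∎

%-cong-*ʳ : ∀ {d} .{{_ : NonZero d}} a {y y′} → y % d ≡ y′ % d → (a * y) % d ≡ (a * y′) % d
%-cong-*ʳ a = %-cong-* {x = a} {x′ = a} refl

module _ (d : ℕ) .{{_ : NonZero d}} where

  pellStep : ℕ × ℕ → ℕ × ℕ
  pellStep (a , b) = b , (2 * b + a) % d

  repStep : ℕ → ℕ
  repStep r = (10 * r + 1) % d

  Q-pair-mod : ∀ k → (Q k % d , Q (suc k) % d) ≡ iterate pellStep (2 % d , 2 % d) k
  Q-pair-mod = recurrence⇒iterate pellStep (λ k → Q k % d , Q (suc k) % d) step
    where
    step : ∀ k → (Q (suc k) % d , Q (suc (suc k)) % d) ≡ pellStep (Q k % d , Q (suc k) % d)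
    step k = cong (Q (suc k) % d ,_)
      (%-cong-+ (%-cong-*ʳ 2 (sym (m%n%n≡m%n (Q (suc k)) d))) (sym (m%n%n≡m%n (Q k) d)))

  rep-mod : ∀ t → rep (4 + t) % d ≡ iterate repStep (1111 % d) t
  rep-mod = recurrence⇒iterate repStep (λ t → rep (4 + t) % d) step
    where
    step : ∀ t → rep (5 + t) % d ≡ repStep (rep (4 + t) % d)
    step t = %-cong-+ (%-cong-*ʳ 10 (sym (m%n%n≡m%n (rep (4 + t)) d))) refl

rep-%10000 : ∀ t → rep (4 + t) % 10000 ≡ 1111
rep-%10000 t = trans (rep-mod 10000 t) (iterate-fixed (repStep 10000) refl t)

M : ℕ
M = 10000 * 13211

pellOrbit : List ℕ
pellOrbit = map proj₁ (List.iterate (pellStep M) (2 , 2) 3000)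

repOrbit : List ℕ
repOrbit = List.iterate (repStep M) 1111 200

Q%M∈pellOrbit : ∀ k → Q k % M ∈ pellOrbit
Q%M∈pellOrbit k = subst (_∈ pellOrbit) (sym Q%M≡) (∈-map⁺ proj₁ (∈-iterate (pellStep M) (m%n<n k 3000)))
  where
  period : iterate (pellStep M) (2 , 2) 3000 ≡ (2 , 2)
  period = refl
  Q%M≡ : Q k % M ≡ proj₁ (iterate (pellStep M) (2 , 2) (k % 3000))
  Q%M≡ = cong proj₁ (trans (Q-pair-mod M k) (iterate-% (pellStep M) {2 , 2} 3000 period k))

rep%M∈repOrbit : ∀ t → rep (4 + t) % M ∈ repOrbit
rep%M∈repOrbit t = subst (_∈ repOrbit) (sym rep%M≡) (∈-iterate (repStep M) (m%n<n t 200))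
  where
  period : iterate (repStep M) 1111 200 ≡ 1111
  period = refl
  rep%M≡ : rep (4 + t) % M ≡ iterate (repStep M) 1111 (t % 200)
  rep%M≡ = trans (rep-mod M t) (iterate-% (repStep M) {1111} 200 period t)

digits : List ℕ
digits = applyUpTo suc 9

Digit : ℕ → Set
Digit a = 1 ≤ a × a ≤ 9

digit∈digits : ∀ {a} → Digit a → a ∈ digits
digit∈digits {suc a} (_ , a<9) = ∈-applyUpTo⁺ suc a<9

smallRepunits : List ℕ
smallRepunits = rep 1 ∷ rep 2 ∷ rep 3 ∷ []

last4 : ℕ → ℕ → ℕ → ℕ
last4 q a₂ r = (q + a₂ * r) % 10000

NotRepdigit⁴ : ℕ → Set
NotRepdigit⁴ u = u ≡ 0 ⊎ 1111 ∤ u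

ResiduesDiffer : ℕ → ℕ → ℕ → ℕ → Set
ResiduesDiffer q a₂ a₁ r = All (λ Y → (q + a₂ * r) % M ≢ (a₁ * Y) % M) repOrbit

-- r = 1111 stands for every repunit with at least four digits; for the shorter ones the
-- last four digits determine the candidate a₁, whose residue modulo M is then compared.
Sieved : ℕ → Set
Sieved q = All (λ a₂ →
  NotRepdigit⁴ (last4 q a₂ 1111) ×
  All (λ r → NotRepdigit⁴ (last4 q a₂ r) ⊎ ResiduesDiffer q a₂ (last4 q a₂ r / 1111) r) smallRepunits)
  digits

pellOrbit-sieved : All Sieved pellOrbit
pellOrbit-sieved = toWitness {a? = all? sieved? pellOrbit} _
  where
  notRepdigit⁴? : ∀ u → Dec (NotRepdigit⁴ u)
  notRepdigit⁴? u = u ≟ 0 ⊎-dec ¬? (1111 ∣? u)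
  residuesDiffer? : ∀ q a₂ a₁ r → Dec (ResiduesDiffer q a₂ a₁ r)
  residuesDiffer? q a₂ a₁ r = all? (λ Y → ¬? ((q + a₂ * r) % M ≟ (a₁ * Y) % M)) repOrbit
  sieved? : ∀ q → Dec (Sieved q)
  sieved? q = all? (λ a₂ →
    notRepdigit⁴? (last4 q a₂ 1111) ×-dec
    all? (λ r → notRepdigit⁴? (last4 q a₂ r) ⊎-dec residuesDiffer? q a₂ (last4 q a₂ r / 1111) r) smallRepunits)
    digits

repdigit⁴-not-excluded : ∀ {a} → 1 ≤ a → ¬ NotRepdigit⁴ (a * 1111)
repdigit⁴-not-excluded {suc a} _ (inj₁ ())
repdigit⁴-not-excluded {suc a} _ (inj₂ 1111∤) = 1111∤ (n∣m*n (suc a))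

module _ (q : ℕ) {a₂} (sieved : Sieved q) (a₂∈ : a₂ ∈ digits) {a₁} (1≤a₁ : 1 ≤ a₁) where

  sieve-excludes-long : last4 q a₂ 1111 ≢ a₁ * 1111
  sieve-excludes-long low = repdigit⁴-not-excluded 1≤a₁ (subst NotRepdigit⁴ low (proj₁ (All.lookup sieved a₂∈)))

  sieve-excludes-short : ∀ {r Y} → r ∈ smallRepunits → Y ∈ repOrbit →
                         last4 q a₂ r ≡ a₁ * 1111 → (q + a₂ * r) % M ≢ (a₁ * Y) % M
  sieve-excludes-short {r} r∈ Y∈ low with All.lookup (proj₂ (All.lookup sieved a₂∈)) r∈
  ... | inj₁ notRepdigit = ⊥-elim (repdigit⁴-not-excluded 1≤a₁ (subst NotRepdigit⁴ low notRepdigit))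
  ... | inj₂ differ = All.lookup (subst (λ a → ResiduesDiffer q a₂ a r) a₁≡ differ) Y∈
    where
    a₁≡ : last4 q a₂ r / 1111 ≡ a₁
    a₁≡ = trans (cong (_/ 1111) low) (m*n/n≡m a₁ 1111)

module _ (k m t : ℕ) {a₁ a₂} (a₁-digit : Digit a₁) (a₂∈ : a₂ ∈ digits)
         (eq : Q k + a₂ * rep m ≡ a₁ * rep (4 + t)) where

  private
    solution-mod : ∀ {d e} .{{_ : NonZero d}} .{{_ : NonZero e}} → e ∣ d → ∀ r → rep m % e ≡ r % e →
                   (Q k % d + a₂ * r) % e ≡ (a₁ * (rep (4 + t) % e)) % e
    solution-mod {d} {e} e∣d r rep-m≡r = begin
      (Q k % d + a₂ * r) % e           ≡⟨ %-cong-+ (m∣n⇒o%n%m≡o%m e d (Q k) e∣d) (%-cong-*ʳ a₂ (sym rep-m≡r)) ⟩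
      (Q k + a₂ * rep m) % e           ≡⟨ cong (_% e) eq ⟩
      (a₁ * rep (4 + t)) % e           ≡⟨ %-cong-*ʳ a₁ (sym (m%n%n≡m%n (rep (4 + t)) e)) ⟩
      (a₁ * (rep (4 + t) % e)) % e     ∎
      where open ≡-Reasoning

    solution-mod-10000 : ∀ r → rep m % 10000 ≡ r % 10000 → last4 (Q k % M) a₂ r ≡ a₁ * 1111
    solution-mod-10000 r rep-m≡r = begin
      last4 (Q k % M) a₂ r                 ≡⟨ solution-mod (divides 13211 refl) r rep-m≡r ⟩
      (a₁ * (rep (4 + t) % 10000)) % 10000 ≡⟨ cong (λ x → (a₁ * x) % 10000) (rep-%10000 t) ⟩
      (a₁ * 1111) % 10000                  ≡⟨ m<n⇒m%n≡m (s≤s (*-monoˡ-≤ 1111 (proj₂ a₁-digit))) ⟩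
      a₁ * 1111                            ∎
      where open ≡-Reasoning

    sieved : Sieved (Q k % M)
    sieved = All.lookup pellOrbit-sieved (Q%M∈pellOrbit k)

  no-solution-with-long-m : rep m % 10000 ≡ 1111 → ⊥
  no-solution-with-long-m rep-m≡ =
    sieve-excludes-long (Q k % M) sieved a₂∈ (proj₁ a₁-digit) (solution-mod-10000 1111 rep-m≡)

  no-solution-with-short-m : rep m ∈ smallRepunits → ⊥
  no-solution-with-short-m rep-m∈ =
    sieve-excludes-short (Q k % M) sieved a₂∈ (proj₁ a₁-digit) rep-m∈ (rep%M∈repOrbit t)
      (solution-mod-10000 (rep m) refl) (solution-mod {d = M} ∣-refl (rep m) refl)

no-solution-with-long-n : ∀ k m t {a₁ a₂} → Digit a₁ → Digit a₂ → 1 ≤ m → Q k + a₂ * rep m ≢ a₁ * rep (4 + t)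
no-solution-with-long-n k 1 t a₁ a₂ _ eq = no-solution-with-short-m k 1 t a₁ (digit∈digits a₂) eq (here refl)
no-solution-with-long-n k 2 t a₁ a₂ _ eq = no-solution-with-short-m k 2 t a₁ (digit∈digits a₂) eq (there (here refl))
no-solution-with-long-n k 3 t a₁ a₂ _ eq = no-solution-with-short-m k 3 t a₁ (digit∈digits a₂) eq (there (there (here refl)))
no-solution-with-long-n k m@(suc (suc (suc (suc s)))) t a₁ a₂ _ eq =
  no-solution-with-long-m k m t a₁ (digit∈digits a₂) eq (rep-%10000 s)

Exceptional : ℕ → Set
Exceptional x = x ≡ 2 ⊎ x ≡ 5 ⊎ x ≡ 6 ⊎ x ≡ 14 ⊎ x ≡ 34 ⊎ x ≡ 82 ⊎ x ≡ 478

Q[k]≤Q[1+k] : ∀ k → Q k ≤ Q (suc k)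
Q[k]≤Q[1+k] zero    = ≤-refl
Q[k]≤Q[1+k] (suc k) = ≤-trans (m≤m+n (Q (suc k)) (Q (suc k) + 0)) (m≤m+n (2 * Q (suc k)) (Q k))

1154≤Q : ∀ k → 1154 ≤ Q (8 + k)
1154≤Q zero    = ≤-refl
1154≤Q (suc k) = ≤-trans (1154≤Q k) (Q[k]≤Q[1+k] (8 + k))

Q≤999⇒exceptional : ∀ k → Q k ≤ 999 → Exceptional (Q k) ⊎ Q k ≡ 198
Q≤999⇒exceptional 0 _ = inj₁ (inj₁ refl)
Q≤999⇒exceptional 1 _ = inj₁ (inj₁ refl)
Q≤999⇒exceptional 2 _ = inj₁ (inj₂ (inj₂ (inj₁ refl)))
Q≤999⇒exceptional 3 _ = inj₁ (inj₂ (inj₂ (inj₂ (inj₁ refl))))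
Q≤999⇒exceptional 4 _ = inj₁ (inj₂ (inj₂ (inj₂ (inj₂ (inj₁ refl)))))
Q≤999⇒exceptional 5 _ = inj₁ (inj₂ (inj₂ (inj₂ (inj₂ (inj₂ (inj₁ refl))))))
Q≤999⇒exceptional 6 _ = inj₂ refl
Q≤999⇒exceptional 7 _ = inj₁ (inj₂ (inj₂ (inj₂ (inj₂ (inj₂ (inj₂ refl))))))
Q≤999⇒exceptional (suc (suc (suc (suc (suc (suc (suc (suc k)))))))) Q≤999 =
  ⊥-elim (≤⇒≤ᵇ (≤-trans (1154≤Q k) Q≤999))

rep≤999⇒short : ∀ {m} → 1 ≤ m → rep m ≤ 999 → m ∈ 1 ∷ 2 ∷ 3 ∷ []
rep≤999⇒short {1} _ _ = here refl
rep≤999⇒short {2} _ _ = there (here refl)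
rep≤999⇒short {3} _ _ = there (there (here refl))
rep≤999⇒short {suc (suc (suc (suc s)))} _ rep≤999 = ⊥-elim (≤⇒≤ᵇ (≤-trans (1111≤rep s) rep≤999))

rep≤111 : ∀ {n} → n ∈ 2 ∷ 3 ∷ [] → rep n ≤ 111
rep≤111 (here refl)         = ≤ᵇ⇒≤ 11 111 _
rep≤111 (there (here refl)) = ≤-refl

no-solution-with-Q≡198 : ∀ {m n a₁ a₂} → a₁ ∈ digits → a₂ ∈ digits → m ∈ 1 ∷ 2 ∷ 3 ∷ [] → n ∈ 2 ∷ 3 ∷ [] →
                         198 + a₂ * rep m ≢ a₁ * rep n
no-solution-with-Q≡198 a₁∈ a₂∈ m∈ n∈ = All.lookup (All.lookup (All.lookup (All.lookup table a₁∈) a₂∈) m∈) n∈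
  where
  table : All (λ a₁ → All (λ a₂ → All (λ m → All (λ n → 198 + a₂ * rep m ≢ a₁ * rep n)
            (2 ∷ 3 ∷ [])) (1 ∷ 2 ∷ 3 ∷ [])) digits) digits
  table = toWitness {a? = all? (λ a₁ → all? (λ a₂ → all? (λ m → all? (λ n → ¬? (198 + a₂ * rep m ≟ a₁ * rep n))
            (2 ∷ 3 ∷ [])) (1 ∷ 2 ∷ 3 ∷ [])) digits) digits} _

solutions-with-short-n : ∀ k m {n a₁ a₂} → Digit a₁ → Digit a₂ → 1 ≤ m → n ∈ 2 ∷ 3 ∷ [] →
                         Q k + a₂ * rep m ≡ a₁ * rep n → Exceptional (Q k)
solutions-with-short-n k m {n} {a₁} {a₂} a₁-digit a₂-digit 1≤m n∈ eq =
  [ id , ⊥-elim ∘ Q≢198 ]′ (Q≤999⇒exceptional k (≤-trans (m≤m+n (Q k) (a₂ * rep m)) sum≤999))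
  where
  sum≤999 : Q k + a₂ * rep m ≤ 999
  sum≤999 = subst (_≤ 999) (sym eq) (*-mono-≤ (proj₂ a₁-digit) (rep≤111 n∈))
  rep≤999 : rep m ≤ 999
  rep≤999 = ≤-trans (m≤n*m (rep m) a₂ {{>-nonZero (proj₁ a₂-digit)}}) (≤-trans (m≤n+m (a₂ * rep m) (Q k)) sum≤999)
  Q≢198 : Q k ≢ 198
  Q≢198 Q≡198 = no-solution-with-Q≡198 (digit∈digits a₁-digit) (digit∈digits a₂-digit)
    (rep≤999⇒short 1≤m rep≤999) n∈ (subst (λ x → x + a₂ * rep m ≡ a₁ * rep n) Q≡198 eq)

solutions-are-exceptional : ∀ k n m {a₁ a₂} → 2 ≤ n → 1 ≤ m → Digit a₁ → Digit a₂ →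
                            Q k + a₂ * rep m ≡ a₁ * rep n → Exceptional (Q k)
solutions-are-exceptional k 1 m (s≤s ()) _ _ _ _
solutions-are-exceptional k 2 m _ 1≤m a₁ a₂ eq = solutions-with-short-n k m a₁ a₂ 1≤m (here refl) eq
solutions-are-exceptional k 3 m _ 1≤m a₁ a₂ eq = solutions-with-short-n k m a₁ a₂ 1≤m (there (here refl)) eq
solutions-are-exceptional k (suc (suc (suc (suc t)))) m _ 1≤m a₁ a₂ eq =
  ⊥-elim (no-solution-with-long-n k m t a₁ a₂ 1≤m eq)

theorem2 : ((k n m a₁ a₂ : ℕ) → 2 ≤ n → 1 ≤ m → 1 ≤ a₁ → a₁ ≤ 9 → 1 ≤ a₂ → a₂ ≤ 9 →
    Q k + repdigit a₂ m ≡ repdigit a₁ n →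
    Q k ≡ 2 ⊎ Q k ≡ 5 ⊎ Q k ≡ 6 ⊎ Q k ≡ 14 ⊎ Q k ≡ 34 ⊎ Q k ≡ 82 ⊎ Q k ≡ 478)
    × (2 ≡ repdigit 1 2 ∸ repdigit 9 1)
    × (6 ≡ repdigit 1 2 ∸ repdigit 5 1)
    × (14 ≡ repdigit 2 2 ∸ repdigit 8 1)
    × (34 ≡ repdigit 1 3 ∸ repdigit 7 2)
    × (82 ≡ repdigit 8 2 ∸ repdigit 6 1)
    × (478 ≡ repdigit 5 3 ∸ repdigit 7 2)
theorem2 = solutions , refl , refl , refl , refl , refl , refl
  where
  solutions : (k n m a₁ a₂ : ℕ) → 2 ≤ n → 1 ≤ m → 1 ≤ a₁ → a₁ ≤ 9 → 1 ≤ a₂ → a₂ ≤ 9 →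
              Q k + repdigit a₂ m ≡ repdigit a₁ n → Exceptional (Q k)
  solutions k n m a₁ a₂ 2≤n 1≤m 1≤a₁ a₁≤9 1≤a₂ a₂≤9 eq =
    solutions-are-exceptional k n m 2≤n 1≤m (1≤a₁ , a₁≤9) (1≤a₂ , a₂≤9)
      (subst₂ (λ x y → Q k + a₂ * x ≡ a₁ * y) (repunit≡rep m) (repunit≡rep n) eq)
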